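{- Let $\mathcal{C},\mathcal{D}$ be categories and $F\colon\mathcal{C}\to\mathcal{D}^{op}$ left adjoint to $G\colon\mathcal{D}^{op}\to\mathcal{C}$. Let $A$ be an endofunctor on $\mathcal{C}$ with initial algebra $\beta\colon A(\Psi)\xrightarrow{\cong}\Psi$, $(T,\eta,\mu)$ a monad on $\mathcal{C}$, $\lambda\colon AT\Rightarrow TA$ a Kleisli law such that $(\Psi,J(\beta^{ -1}))$ is a final coalgebra of the extension $\overline{A}$ of $A$ to $\mathcal{K}\ell(T)$, $L$ an endofunctor on $\mathcal{D}$ with initial algebra $\alpha\colon L(\Phi)\xrightarrow{\cong}\Phi$, $\delta\colon AG\Rightarrow GL$ a natural transformation and $\tau\colon TG\Rightarrow G$ a monad action. Assume $\delta\circ A\tau=\tau L\circ T\delta\circ\lambda G$. Let $\mathsf{k}\colon\Psi\to G(\Phi)$ be the unique map with $\mathsf{k}\circ\beta=G(\alpha^{ -1})\circ\delta_\Phi\circ A(\mathsf{k})$, and $\overline{\mathsf{k}}=\tau_\Phi\circ T(\mathsf{k})\colon T(\Psi)\to G(\Phi)$. Let $\ell_{\mathrm{kl}}=T(\beta)\circ\mu_{A(\Psi)}\circ T(\lambda_\Psi)\colon TAT(\Psi)\to T(\Psi)$ and $\ell_{\mathrm{log}}=G(\alpha^{ -1})\circ\tau_{L(\Phi)}\circ T(\delta_\Phi)\colon TAG(\Phi)\to G(\Phi)$. Then $\overline{\mathsf{k}}\circ\ell_{\mathrm{kl}}=\ell_{\mathrm{log}}\circ TA(\overline{\mathsf{k}})$.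 Consequently, for every coalgebra $c\colon X\to TA(X)$, $\overline{\mathsf{k}}\circ\mathsf{kl}_c=\mathsf{log}_c$, where $\mathsf{kl}_c\colon X\to T(\Psi)$ is the unique map with $\mathsf{kl}_c=\ell_{\mathrm{kl}}\circ TA(\mathsf{kl}_c)\circ c$ and $\mathsf{log}_c\colon X\to G(\Phi)$ is the unique map with $\mathsf{log}_c=\ell_{\mathrm{log}}\circ TA(\mathsf{log}_c)\circ c$.
   Context: $L$ is also regarded as an endofunctor of $\mathcal{D}^{op}$; $G(\alpha^{ -1})\colon GL(\Phi)\to G(\Phi)$ is $G$ applied to $\alpha^{ -1}$ viewed as a morphism $L(\Phi)\to\Phi$ in $\mathcal{D}^{op}$. A Kleisli law satisfies $\lambda\circ A\eta=\eta A$ and $\lambda\circ A\mu=\mu A\circ T\lambda\circ\lambda T$; its extension $\overline{A}$ to the Kleisli category sends a Kleisli map $f\colon X\to T(Y)$ to $\lambda_Y\circ A(f)$, and $J\colon\mathcal{C}\to\mathcal{K}\ell(T)$ is the identity on objects with $J(f)=\eta\circ f$. A monad action satisfies $\tau\circ\eta G=\mathrm{id}$ and $\tau\circ\mu G=\tau\circ T\tau$. The maps $\mathsf{k}$, $\mathsf{kl}_c$, $\mathsf{log}_c$ described exist and are unique. -}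

module Defs where

open import Level using (Level; _⊔_) renaming (suc to lsuc)
open import Relation.Binary.PropositionalEquality using (_≡_; sym)
open import Data.Product using (∃!)

record Category (o ℓ : Level) : Set (lsuc (o ⊔ ℓ)) where
  infixr 9 _∘_
  field
    Obj : Set o
    Hom : Obj → Obj → Set ℓ
    id  : ∀ {X} → Hom X X
    _∘_ : ∀ {X Y Z} → Hom Y Z → Hom X Y → Hom X Z
    identityˡ : ∀ {X Y} {f : Hom X Y} → id ∘ f ≡ f
    identityʳ : ∀ {X Y} {f : Hom X Y} → f ∘ id ≡ f
    assoc : ∀ {W X Y Z} {f : Hom W X} {g : Hom X Y} {h : Hom Y Z} →
            (h ∘ g) ∘ f ≡ h ∘ (g ∘ f)

open Category public using (Obj; Hom)

comp : ∀ {o ℓ} (C : Category o ℓ) {X Y Z : Obj C} →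
       Hom C Y Z → Hom C X Y → Hom C X Z
comp C g f = Category._∘_ C g f

infixr 9 comp
syntax comp C g f = g ∘⟨ C ⟩ f

op : ∀ {o ℓ} → Category o ℓ → Category o ℓ
op C = record
  { Obj = Obj C
  ; Hom = λ X Y → Hom C Y X
  ; id = Category.id C
  ; _∘_ = λ g f → Category._∘_ C f g
  ; identityˡ = Category.identityʳ C
  ; identityʳ = Category.identityˡ C
  ; assoc = sym (Category.assoc C)
  }

record Functor {o ℓ o' ℓ'} (C : Category o ℓ) (D : Category o' ℓ')
       : Set (o ⊔ ℓ ⊔ o' ⊔ ℓ') where
  field
    F₀ : Obj C → Obj D
    F₁ : ∀ {X Y} → Hom C X Y → Hom D (F₀ X) (F₀ Y)
    identity : ∀ {X} → F₁ (Category.id C {X}) ≡ Category.id D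
    homomorphism : ∀ {X Y Z} {f : Hom C X Y} {g : Hom C Y Z} →
                   F₁ (g ∘⟨ C ⟩ f) ≡ F₁ g ∘⟨ D ⟩ F₁ f

open Functor public

Idᶠ : ∀ {o ℓ} (C : Category o ℓ) → Functor C C
Idᶠ C = record { F₀ = λ X → X ; F₁ = λ f → f
               ; identity = Relation.Binary.PropositionalEquality.refl
               ; homomorphism = Relation.Binary.PropositionalEquality.refl }
  where import Relation.Binary.PropositionalEquality

infixr 9 _∘F_
_∘F_ : ∀ {o₁ ℓ₁ o₂ ℓ₂ o₃ ℓ₃} {C : Category o₁ ℓ₁} {D : Category o₂ ℓ₂}
         {E : Category o₃ ℓ₃} → Functor D E → Functor C D → Functor C E
_∘F_ {E = E} G F = record
  { F₀ = λ X → F₀ G (F₀ F X)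
  ; F₁ = λ f → F₁ G (F₁ F f)
  ; identity = trans (cong (F₁ G) (identity F)) (identity G)
  ; homomorphism = trans (cong (F₁ G) (homomorphism F)) (homomorphism G)
  }
  where open import Relation.Binary.PropositionalEquality using (trans; cong)

opF : ∀ {o ℓ o' ℓ'} {C : Category o ℓ} {D : Category o' ℓ'} →
      Functor C D → Functor (op C) (op D)
opF F = record { F₀ = F₀ F ; F₁ = F₁ F ; identity = identity F
               ; homomorphism = homomorphism F }

record NatTrans {o ℓ o' ℓ'} {C : Category o ℓ} {D : Category o' ℓ'}
       (F G : Functor C D) : Set (o ⊔ ℓ ⊔ ℓ') where
  field
    at : ∀ X → Hom D (F₀ F X) (F₀ G X)
    commute : ∀ {X Y} (f : Hom C X Y) →
              at Y ∘⟨ D ⟩ F₁ F f ≡ F₁ G f ∘⟨ D ⟩ at X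

open NatTrans public

record Adjunction {o ℓ o' ℓ'} {C : Category o ℓ} {E : Category o' ℓ'}
       (F : Functor C E) (G : Functor E C) : Set (o ⊔ ℓ ⊔ o' ⊔ ℓ') where
  field
    unit   : NatTrans (Idᶠ C) (G ∘F F)
    counit : NatTrans (F ∘F G) (Idᶠ E)
    zig : ∀ X → at counit (F₀ F X) ∘⟨ E ⟩ F₁ F (at unit X) ≡ Category.id E
    zag : ∀ Y → F₁ G (at counit Y) ∘⟨ C ⟩ at unit (F₀ G Y) ≡ Category.id C

record IsIso {o ℓ} (C : Category o ℓ) {X Y : Obj C}
       (f : Hom C X Y) (g : Hom C Y X) : Set ℓ where
  field
    isoˡ : g ∘⟨ C ⟩ f ≡ Category.id C
    isoʳ : f ∘⟨ C ⟩ g ≡ Category.id C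

IsInitialAlgebra : ∀ {o ℓ} (C : Category o ℓ) (A : Functor C C)
                   (Ψ : Obj C) (β : Hom C (F₀ A Ψ) Ψ) → Set (o ⊔ ℓ)
IsInitialAlgebra C A Ψ β =
  ∀ (X : Obj C) (a : Hom C (F₀ A X) X) →
  ∃! _≡_ (λ (h : Hom C Ψ X) → h ∘⟨ C ⟩ β ≡ a ∘⟨ C ⟩ F₁ A h)

record Monad {o ℓ} (C : Category o ℓ) : Set (o ⊔ ℓ) where
  field
    T : Functor C C
    η : NatTrans (Idᶠ C) T
    μ : NatTrans (T ∘F T) T
    unitˡ : ∀ X → at μ X ∘⟨ C ⟩ F₁ T (at η X) ≡ Category.id C
    unitʳ : ∀ X → at μ X ∘⟨ C ⟩ at η (F₀ T X) ≡ Category.id C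
    mult-assoc : ∀ X → at μ X ∘⟨ C ⟩ F₁ T (at μ X)
                       ≡ at μ X ∘⟨ C ⟩ at μ (F₀ T X)

open Monad public using (T; η; μ)

record KleisliLaw {o ℓ} {C : Category o ℓ} (A : Functor C C) (M : Monad C)
       : Set (o ⊔ ℓ) where
  field
    lam : NatTrans (A ∘F T M) (T M ∘F A)
    law-η : ∀ X → at lam X ∘⟨ C ⟩ F₁ A (at (η M) X) ≡ at (η M) (F₀ A X)
    law-μ : ∀ X → at lam X ∘⟨ C ⟩ F₁ A (at (μ M) X)
                ≡ at (μ M) (F₀ A X) ∘⟨ C ⟩ (F₁ (T M) (at lam X)
                                           ∘⟨ C ⟩ at lam (F₀ (T M) X))

open KleisliLaw public using (lam)

module _ {o ℓ} {C : Category o ℓ} (M : Monad C) where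
  klComp : ∀ {X Y Z} → Hom C Y (F₀ (T M) Z) → Hom C X (F₀ (T M) Y) →
           Hom C X (F₀ (T M) Z)
  klComp g f = at (μ M) _ ∘⟨ C ⟩ (F₁ (T M) g ∘⟨ C ⟩ f)

  J : ∀ {X Y} → Hom C X Y → Hom C X (F₀ (T M) Y)
  J f = at (η M) _ ∘⟨ C ⟩ f

-- extension Ā of A to Kl(T): on a Kleisli map f : X → T Y, Ā f = λ_Y ∘ A f
Ext₁ : ∀ {o ℓ} {C : Category o ℓ} {A : Functor C C} {M : Monad C} →
       KleisliLaw A M → ∀ {X Y} → Hom C X (F₀ (T M) Y) →
       Hom C (F₀ A X) (F₀ (T M) (F₀ A Y))
Ext₁ {C = C} {A = A} κ f = at (lam κ) _ ∘⟨ C ⟩ F₁ A f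

IsFinalKlCoalgebra : ∀ {o ℓ} {C : Category o ℓ} {A : Functor C C} (M : Monad C) →
  KleisliLaw A M → (Ψ : Obj C) → Hom C Ψ (F₀ (T M) (F₀ A Ψ)) → Set (o ⊔ ℓ)
IsFinalKlCoalgebra {C = C} {A} M κ Ψ γ =
  ∀ (X : Obj C) (c : Hom C X (F₀ (T M) (F₀ A X))) →
  ∃! _≡_ (λ (h : Hom C X (F₀ (T M) Ψ)) →
            klComp M γ h ≡ klComp M (Ext₁ κ h) c)

record MonadAction {o ℓ o' ℓ'} {C : Category o ℓ} {E : Category o' ℓ'}
       (M : Monad C) (G : Functor E C) : Set (o ⊔ ℓ ⊔ o' ⊔ ℓ') where
  field
    τ : NatTrans (T M ∘F G) G
    act-η : ∀ X → at τ X ∘⟨ C ⟩ at (η M) (F₀ G X) ≡ Category.id C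
    act-μ : ∀ X → at τ X ∘⟨ C ⟩ at (μ M) (F₀ G X)
                ≡ at τ X ∘⟨ C ⟩ F₁ (T M) (at τ X)

open MonadAction public using (τ)

-- Writing k̄ = τ ∘ T k for the extension of k along the action τ, the
-- equation k ∘ β = G(α⁻¹) ∘ δ ∘ A k extends, through the action laws, the
-- Kleisli law and the compatibility of δ with τ and λ, to the statement that
-- k̄ is a homomorphism from the Kleisli algebra ℓkl to the algebra ℓlog.
-- Hence k̄ ∘ kl_c solves the defining equation of log_c. Such solutions are
-- unique: transposing a solution along F ⊣ G gives an L-algebra morphism out
-- of the initial algebra (Φ, α).
module Submission where

open import Relation.Binary.PropositionalEquality
  using (_≡_; sym; trans; cong; module ≡-Reasoning)
open import Data.Product using (_×_; _,_; proj₁; proj₂)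

open import Defs

module MorphismReasoning {o ℓ} (K : Category o ℓ) where
  open Category K using (_∘_; assoc)

  pullˡ : ∀ {W X Y Z} {a : Hom K Y Z} {b : Hom K X Y} {c : Hom K X Z}
            {f : Hom K W X} →
          a ∘ b ≡ c → a ∘ (b ∘ f) ≡ c ∘ f
  pullˡ {f = f} e = trans (sym assoc) (cong (_∘ f) e)

  pullʳ : ∀ {W X Y Z} {a : Hom K X Y} {b : Hom K W X} {c : Hom K W Y}
            {f : Hom K Y Z} →
          a ∘ b ≡ c → (f ∘ a) ∘ b ≡ f ∘ c
  pullʳ {f = f} e = trans assoc (cong (f ∘_) e)

  extendʳ : ∀ {W X Y Y' Z} {a : Hom K Y Z} {b : Hom K X Y} {c : Hom K Y' Z}
              {d : Hom K X Y'} {f : Hom K W X} →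
            a ∘ b ≡ c ∘ d → a ∘ (b ∘ f) ≡ c ∘ (d ∘ f)
  extendʳ e = trans (pullˡ e) assoc

module _ {o ℓ} {C : Category o ℓ} (H : Functor C C) where
  open Category C using (_∘_)
  open MorphismReasoning C

  IsAlgebraHom : ∀ {Y Z} → Hom C (F₀ H Y) Y → Hom C (F₀ H Z) Z →
                 Hom C Y Z → Set ℓ
  IsAlgebraHom a b g = g ∘ a ≡ b ∘ F₁ H g

  IsCoalgebraToAlgebra : ∀ {X Y} → Hom C X (F₀ H X) → Hom C (F₀ H Y) Y →
                         Hom C X Y → Set ℓ
  IsCoalgebraToAlgebra c a x = x ≡ a ∘ (F₁ H x ∘ c)

  algebraHom-∘-coalgebraToAlgebra :
    ∀ {X Y Z} {c : Hom C X (F₀ H X)} {a : Hom C (F₀ H Y) Y}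
      {b : Hom C (F₀ H Z) Z} {g : Hom C Y Z} {x : Hom C X Y} →
    IsAlgebraHom a b g → IsCoalgebraToAlgebra c a x →
    IsCoalgebraToAlgebra c b (g ∘ x)
  algebraHom-∘-coalgebraToAlgebra {c = c} {a} {b} {g} {x} hom solves = begin
    g ∘ x                      ≡⟨ cong (g ∘_) solves ⟩
    g ∘ (a ∘ (F₁ H x ∘ c))     ≡⟨ pullˡ hom ⟩
    (b ∘ F₁ H g) ∘ (F₁ H x ∘ c) ≡⟨ pullʳ (pullˡ (sym (homomorphism H))) ⟩
    b ∘ (F₁ H (g ∘ x) ∘ c)     ∎
    where open ≡-Reasoning

  initialAlgebra-hom-unique :
    ∀ {Φ X} {α : Hom C (F₀ H Φ) Φ} {a : Hom C (F₀ H X) X} {g h : Hom C Φ X} →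
    IsInitialAlgebra C H Φ α →
    IsAlgebraHom α a g → IsAlgebraHom α a h → g ≡ h
  initialAlgebra-hom-unique {X = X} {α} {a} initial g-hom h-hom =
    trans (sym (unique g-hom)) (unique h-hom)
    where
    unique : ∀ {h} → IsAlgebraHom α a h → proj₁ (initial X a) ≡ h
    unique = proj₂ (proj₂ (initial X a))

module Transpose {o ℓ o' ℓ'} {C : Category o ℓ} {E : Category o' ℓ'}
                 {F : Functor C E} {G : Functor E C} (adj : Adjunction F G) where
  open Adjunction adj
  open Category C using (_∘_; identityˡ)
  module E = Category E
  open MorphismReasoning C

  transpose : ∀ {X Y} → Hom C X (F₀ G Y) → Hom E (F₀ F X) Y
  transpose {Y = Y} x = at counit Y E.∘ F₁ F x

  G-transpose∘unit : ∀ {X Y} (x : Hom C X (F₀ G Y)) →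
                     F₁ G (transpose x) ∘ at unit X ≡ x
  G-transpose∘unit {X} {Y} x = begin
    F₁ G (at counit Y E.∘ F₁ F x) ∘ at unit X
      ≡⟨ cong (_∘ at unit X) (homomorphism G) ⟩
    (F₁ G (at counit Y) ∘ F₁ G (F₁ F x)) ∘ at unit X
      ≡⟨ pullʳ (sym (commute unit x)) ⟩
    F₁ G (at counit Y) ∘ (at unit (F₀ G Y) ∘ x)
      ≡⟨ pullˡ (zag Y) ⟩
    Category.id C ∘ x
      ≡⟨ identityˡ ⟩
    x ∎
    where open ≡-Reasoning

  transpose-unique : ∀ {X Y} {x : Hom C X (F₀ G Y)} {g : Hom E (F₀ F X) Y} →
                     x ≡ F₁ G g ∘ at unit X → transpose x ≡ g
  transpose-unique {X} {Y} {x} {g} x≡ = begin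
    at counit Y E.∘ F₁ F x
      ≡⟨ cong (λ y → at counit Y E.∘ F₁ F y) x≡ ⟩
    at counit Y E.∘ F₁ F (F₁ G g ∘ at unit X)
      ≡⟨ cong (at counit Y E.∘_) (homomorphism F) ⟩
    at counit Y E.∘ (F₁ F (F₁ G g) E.∘ F₁ F (at unit X))
      ≡⟨ MorphismReasoning.extendʳ E (commute counit g) ⟩
    g E.∘ (at counit (F₀ F X) E.∘ F₁ F (at unit X))
      ≡⟨ cong (g E.∘_) (zig X) ⟩
    g E.∘ E.id
      ≡⟨ E.identityʳ ⟩
    g ∎
    where open ≡-Reasoning

module _ {o ℓ o' ℓ'} {C : Category o ℓ} {D : Category o' ℓ'}
         {F : Functor C (op D)} {G : Functor (op D) C} (adj : Adjunction F G)
         (H : Functor C C) {L : Functor D D}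
         (σ : NatTrans (H ∘F G) (G ∘F opF L))
         {Φ : Obj D} {α : Hom D (F₀ L Φ) Φ} {α⁻¹ : Hom D Φ (F₀ L Φ)}
         (isoα : IsIso D α α⁻¹) (initial : IsInitialAlgebra D L Φ α) where
  open Transpose adj
  open Adjunction adj using (unit)
  open Category C using (_∘_; assoc)
  open MorphismReasoning C
  open ≡-Reasoning
  module D = Category D
  module Dᵒ = Category (op D)

  module _ {X : Obj C} (c : Hom C X (F₀ H X)) where
    transposedAlgebra : Hom D (F₀ L (F₀ F X)) (F₀ F X)
    transposedAlgebra = transpose (at σ (F₀ F X) ∘ (F₁ H (at unit X) ∘ c))

    σ-∘-G-transpose : ∀ {Y} (g : Hom (op D) (F₀ F X) Y) →
      at σ Y ∘ (F₁ H (F₁ G g ∘ at unit X) ∘ c)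
        ≡ F₁ G (F₁ L g) ∘ (at σ (F₀ F X) ∘ (F₁ H (at unit X) ∘ c))
    σ-∘-G-transpose g = begin
      at σ _ ∘ (F₁ H (F₁ G g ∘ at unit X) ∘ c)
        ≡⟨ cong (at σ _ ∘_) (trans (cong (_∘ c) (homomorphism H)) assoc) ⟩
      at σ _ ∘ (F₁ H (F₁ G g) ∘ (F₁ H (at unit X) ∘ c))
        ≡⟨ extendʳ (commute σ g) ⟩
      F₁ G (F₁ L g) ∘ (at σ (F₀ F X) ∘ (F₁ H (at unit X) ∘ c)) ∎

    module _ {x : Hom C X (F₀ G Φ)}
             (solves : IsCoalgebraToAlgebra H c (F₁ G α⁻¹ ∘ at σ Φ) x) where
      private
        x̂ : Hom D Φ (F₀ F X)
        x̂ = transpose x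
        a : Hom D (F₀ L (F₀ F X)) (F₀ F X)
        a = transposedAlgebra

      transpose-fixed : x̂ ≡ α⁻¹ Dᵒ.∘ (F₁ L x̂ Dᵒ.∘ a)
      transpose-fixed = transpose-unique (begin
        x
          ≡⟨ trans solves assoc ⟩
        F₁ G α⁻¹ ∘ (at σ Φ ∘ (F₁ H x ∘ c))
          ≡⟨ cong (λ y → F₁ G α⁻¹ ∘ (at σ Φ ∘ (F₁ H y ∘ c)))
                  (sym (G-transpose∘unit x)) ⟩
        F₁ G α⁻¹ ∘ (at σ Φ ∘ (F₁ H (F₁ G x̂ ∘ at unit X) ∘ c))
          ≡⟨ cong (F₁ G α⁻¹ ∘_) (σ-∘-G-transpose x̂) ⟩
        F₁ G α⁻¹ ∘ (F₁ G (F₁ L x̂) ∘ (at σ (F₀ F X) ∘ (F₁ H (at unit X) ∘ c)))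
          ≡⟨ cong (λ y → F₁ G α⁻¹ ∘ (F₁ G (F₁ L x̂) ∘ y))
                  (sym (G-transpose∘unit _)) ⟩
        F₁ G α⁻¹ ∘ (F₁ G (F₁ L x̂) ∘ (F₁ G a ∘ at unit X))
          ≡⟨ cong (F₁ G α⁻¹ ∘_) (pullˡ (sym (homomorphism G))) ⟩
        F₁ G α⁻¹ ∘ (F₁ G (F₁ L x̂ Dᵒ.∘ a) ∘ at unit X)
          ≡⟨ pullˡ (sym (homomorphism G)) ⟩
        F₁ G (α⁻¹ Dᵒ.∘ (F₁ L x̂ Dᵒ.∘ a)) ∘ at unit X ∎)

      transpose-isAlgebraHom : IsAlgebraHom L α a x̂
      transpose-isAlgebraHom = begin
        x̂ D.∘ α                       ≡⟨ cong (D._∘ α) transpose-fixed ⟩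
        ((a D.∘ F₁ L x̂) D.∘ α⁻¹) D.∘ α ≡⟨ MorphismReasoning.pullʳ D (IsIso.isoˡ isoα) ⟩
        (a D.∘ F₁ L x̂) D.∘ D.id        ≡⟨ D.identityʳ ⟩
        a D.∘ F₁ L x̂                   ∎

    coalgebraToAlgebra-unique :
      ∀ {x y : Hom C X (F₀ G Φ)} →
      IsCoalgebraToAlgebra H c (F₁ G α⁻¹ ∘ at σ Φ) x →
      IsCoalgebraToAlgebra H c (F₁ G α⁻¹ ∘ at σ Φ) y → x ≡ y
    coalgebraToAlgebra-unique {x} {y} solves-x solves-y = begin
      x                              ≡⟨ sym (G-transpose∘unit x) ⟩
      F₁ G (transpose x) ∘ at unit X ≡⟨ cong (λ h → F₁ G h ∘ at unit X) x̂≡ŷ ⟩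
      F₁ G (transpose y) ∘ at unit X ≡⟨ G-transpose∘unit y ⟩
      y                              ∎
      where
      x̂≡ŷ : transpose x ≡ transpose y
      x̂≡ŷ = initialAlgebra-hom-unique L initial
              (transpose-isAlgebraHom solves-x) (transpose-isAlgebraHom solves-y)

module Extension {o ℓ o' ℓ'} {C : Category o ℓ} {E : Category o' ℓ'}
                 {M : Monad C} {G : Functor E C} (act : MonadAction M G) where
  open Category C using (_∘_; assoc)
  open MorphismReasoning C
  open ≡-Reasoning

  extend : ∀ {Y Z} → Hom C Y (F₀ G Z) → Hom C (F₀ (T M) Y) (F₀ G Z)
  extend {Z = Z} g = at (τ act) Z ∘ F₁ (T M) g

  extend-∘ : ∀ {X Y Z} {g : Hom C Y (F₀ G Z)} {f : Hom C X Y} →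
             extend g ∘ F₁ (T M) f ≡ extend (g ∘ f)
  extend-∘ = pullʳ (sym (homomorphism (T M)))

  G-∘-extend : ∀ {Y Z Z'} {h : Hom E Z Z'} {g : Hom C Y (F₀ G Z)} →
               F₁ G h ∘ extend g ≡ extend (F₁ G h ∘ g)
  G-∘-extend {h = h} {g} = begin
    F₁ G h ∘ (at (τ act) _ ∘ F₁ (T M) g)
      ≡⟨ pullˡ (sym (commute (τ act) h)) ⟩
    (at (τ act) _ ∘ F₁ (T M) (F₁ G h)) ∘ F₁ (T M) g
      ≡⟨ extend-∘ ⟩
    extend (F₁ G h ∘ g) ∎

  extend-∘-μ : ∀ {Y Z} {g : Hom C Y (F₀ G Z)} →
               extend g ∘ at (μ M) Y ≡ extend (extend g)
  extend-∘-μ {Z = Z} {g} = begin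
    (at (τ act) Z ∘ F₁ (T M) g) ∘ at (μ M) _
      ≡⟨ pullʳ (sym (commute (μ M) g)) ⟩
    at (τ act) Z ∘ (at (μ M) _ ∘ F₁ (T M) (F₁ (T M) g))
      ≡⟨ pullˡ (MonadAction.act-μ act Z) ⟩
    (at (τ act) Z ∘ F₁ (T M) (at (τ act) Z)) ∘ F₁ (T M) (F₁ (T M) g)
      ≡⟨ extend-∘ ⟩
    extend (extend g) ∎

  extendNat : ∀ {B : Functor C C} {L : Functor E E} →
              NatTrans (B ∘F G) (G ∘F L) → NatTrans ((T M ∘F B) ∘F G) (G ∘F L)
  extendNat {B} {L} δ = record
    { at = λ X → extend (at δ X)
    ; commute = λ f → begin
        extend (at δ _) ∘ F₁ (T M) (F₁ B (F₁ G f)) ≡⟨ extend-∘ ⟩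
        extend (at δ _ ∘ F₁ B (F₁ G f))           ≡⟨ cong extend (commute δ f) ⟩
        extend (F₁ G (F₁ L f) ∘ at δ _)           ≡⟨ sym G-∘-extend ⟩
        F₁ G (F₁ L f) ∘ extend (at δ _)           ∎
    }

  module _ {A : Functor C C} {L : Functor E E} (κ : KleisliLaw A M)
           (δ : NatTrans (A ∘F G) (G ∘F L))
           (compatible : ∀ X → at δ X ∘ F₁ A (at (τ act) X)
              ≡ at (τ act) (F₀ L X) ∘ (F₁ (T M) (at δ X) ∘ at (lam κ) (F₀ G X)))
           where

    klAlgebra : ∀ {X} → Hom C (F₀ A X) X →
                Hom C (F₀ (T M) (F₀ A (F₀ (T M) X))) (F₀ (T M) X)
    klAlgebra {X} β = F₁ (T M) β ∘ (at (μ M) (F₀ A X) ∘ F₁ (T M) (at (lam κ) X))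

    logAlgebra : ∀ {Y} → Hom E (F₀ L Y) Y →
                 Hom C (F₀ (T M) (F₀ A (F₀ G Y))) (F₀ G Y)
    logAlgebra b = F₁ G b ∘ extend (at δ _)

    extend-δ-∘-lam : ∀ {Y Z} {g : Hom C Y (F₀ G Z)} →
      extend (at δ Z ∘ F₁ A g) ∘ at (lam κ) Y ≡ at δ Z ∘ F₁ A (extend g)
    extend-δ-∘-lam {Z = Z} {g} = begin
      extend (at δ Z ∘ F₁ A g) ∘ at (lam κ) _
        ≡⟨ cong (_∘ at (lam κ) _) (sym extend-∘) ⟩
      (extend (at δ Z) ∘ F₁ (T M) (F₁ A g)) ∘ at (lam κ) _
        ≡⟨ pullʳ (sym (commute (lam κ) g)) ⟩
      extend (at δ Z) ∘ (at (lam κ) _ ∘ F₁ A (F₁ (T M) g))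
        ≡⟨ trans (sym assoc) (cong (_∘ F₁ A (F₁ (T M) g))
                                   (trans assoc (sym (compatible Z)))) ⟩
      (at δ Z ∘ F₁ A (at (τ act) Z)) ∘ F₁ A (F₁ (T M) g)
        ≡⟨ pullʳ (sym (homomorphism A)) ⟩
      at δ Z ∘ F₁ A (extend g) ∎

    extend-isAlgebraHom :
      ∀ {X Y} {β : Hom C (F₀ A X) X} {b : Hom E (F₀ L Y) Y}
        {k : Hom C X (F₀ G Y)} →
      k ∘ β ≡ F₁ G b ∘ (at δ Y ∘ F₁ A k) →
      IsAlgebraHom (T M ∘F A) (klAlgebra β) (logAlgebra b) (extend k)
    extend-isAlgebraHom {β = β} {b} {k} k-hom = begin
      extend k ∘ (F₁ (T M) β ∘ (at (μ M) _ ∘ F₁ (T M) (at (lam κ) _)))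
        ≡⟨ pullˡ extend-∘ ⟩
      extend (k ∘ β) ∘ (at (μ M) _ ∘ F₁ (T M) (at (lam κ) _))
        ≡⟨ pullˡ extend-∘-μ ⟩
      extend (extend (k ∘ β)) ∘ F₁ (T M) (at (lam κ) _)
        ≡⟨ extend-∘ ⟩
      extend (extend (k ∘ β) ∘ at (lam κ) _)
        ≡⟨ cong extend extended-k-hom ⟩
      extend (F₁ G b ∘ (at δ _ ∘ F₁ A (extend k)))
        ≡⟨ sym G-∘-extend ⟩
      F₁ G b ∘ extend (at δ _ ∘ F₁ A (extend k))
        ≡⟨ cong (F₁ G b ∘_) (sym extend-∘) ⟩
      F₁ G b ∘ (extend (at δ _) ∘ F₁ (T M) (F₁ A (extend k)))
        ≡⟨ sym assoc ⟩
      logAlgebra b ∘ F₁ (T M) (F₁ A (extend k)) ∎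
      where
      extended-k-hom : extend (k ∘ β) ∘ at (lam κ) _
                       ≡ F₁ G b ∘ (at δ _ ∘ F₁ A (extend k))
      extended-k-hom = begin
        extend (k ∘ β) ∘ at (lam κ) _
          ≡⟨ cong (λ h → extend h ∘ at (lam κ) _) k-hom ⟩
        extend (F₁ G b ∘ (at δ _ ∘ F₁ A k)) ∘ at (lam κ) _
          ≡⟨ cong (_∘ at (lam κ) _) (sym G-∘-extend) ⟩
        (F₁ G b ∘ extend (at δ _ ∘ F₁ A k)) ∘ at (lam κ) _
          ≡⟨ pullʳ extend-δ-∘-lam ⟩
        F₁ G b ∘ (at δ _ ∘ F₁ A (extend k)) ∎

open Extension

theorem7p9 :
    ∀ {o ℓ o' ℓ'} (C : Category o ℓ) (D : Category o' ℓ')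
      (F : Functor C (op D)) (G : Functor (op D) C) → Adjunction F G →
      (A : Functor C C) (Ψ : Obj C) (β : Hom C (F₀ A Ψ) Ψ) (β⁻¹ : Hom C Ψ (F₀ A Ψ)) →
      IsIso C β β⁻¹ → IsInitialAlgebra C A Ψ β →
      (M : Monad C) (κ : KleisliLaw A M) → IsFinalKlCoalgebra M κ Ψ (J M β⁻¹) →
      (L : Functor D D) (Φ : Obj D) (α : Hom D (F₀ L Φ) Φ) (α⁻¹ : Hom D Φ (F₀ L Φ)) →
      IsIso D α α⁻¹ → IsInitialAlgebra D L Φ α →
      (δ : NatTrans (A ∘F G) (G ∘F opF L)) (act : MonadAction M G) →
      (∀ (X : Obj D) → at δ X ∘⟨ C ⟩ F₁ A (at (τ act) X)
          ≡ at (τ act) (F₀ L X) ∘⟨ C ⟩ (F₁ (T M) (at δ X) ∘⟨ C ⟩ at (lam κ) (F₀ G X))) →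
      (k : Hom C Ψ (F₀ G Φ)) →
      k ∘⟨ C ⟩ β ≡ F₁ G α⁻¹ ∘⟨ C ⟩ (at δ Φ ∘⟨ C ⟩ F₁ A k) →
      let kbar = at (τ act) Φ ∘⟨ C ⟩ F₁ (T M) k
          ℓkl = F₁ (T M) β ∘⟨ C ⟩ (at (μ M) (F₀ A Ψ) ∘⟨ C ⟩ F₁ (T M) (at (lam κ) Ψ))
          ℓlog = F₁ G α⁻¹ ∘⟨ C ⟩ (at (τ act) (F₀ L Φ) ∘⟨ C ⟩ F₁ (T M) (at δ Φ))
      in (kbar ∘⟨ C ⟩ ℓkl ≡ ℓlog ∘⟨ C ⟩ F₁ (T M) (F₁ A kbar))
         × (∀ (X : Obj C) (c : Hom C X (F₀ (T M) (F₀ A X)))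
              (klc : Hom C X (F₀ (T M) Ψ)) →
              klc ≡ ℓkl ∘⟨ C ⟩ (F₁ (T M) (F₁ A klc) ∘⟨ C ⟩ c) →
              (logc : Hom C X (F₀ G Φ)) →
              logc ≡ ℓlog ∘⟨ C ⟩ (F₁ (T M) (F₁ A logc) ∘⟨ C ⟩ c) →
              kbar ∘⟨ C ⟩ klc ≡ logc)
-- The maps k and kl_c are given together with their defining equations.
theorem7p9 _ _ _ _ adj A _ β _ _ _ M κ _ _ _ _ α⁻¹ isoα initα δ act compatible k k-hom =
  kbar-hom , λ _ c _ klc-solves _ logc-solves →
    coalgebraToAlgebra-unique adj (T M ∘F A) (extendNat act {B = A} δ) isoα initα c
      (algebraHom-∘-coalgebraToAlgebra (T M ∘F A) kbar-hom klc-solves)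
      logc-solves
  where
  kbar-hom : IsAlgebraHom (T M ∘F A) (klAlgebra act κ δ compatible β)
                          (logAlgebra act κ δ compatible α⁻¹) (extend act k)
  kbar-hom = extend-isAlgebraHom act κ δ compatible k-hom
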